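{- In each of the logics DmBL and DmBL$_\ast$, for all $\phi,\psi,\eta\in\mathcal{L}$: (i) $\vdash\bigl((\phi\times\eta)\wedge(\psi\times\eta)\bigr)\rightarrow\Bigl(\Box\bigl((\phi\wedge\eta)\rightarrow(\psi\wedge\eta)\bigr)\rightarrow\bigl(\Box\neg\eta\vee\Box(\phi\rightarrow\psi)\bigr)\Bigr)$; (ii) if $\vdash\phi\times\eta$, $\vdash\psi\times\eta$, $\vdash\Diamond\eta$ and $\phi\wedge\eta\equiv\psi\wedge\eta$, then $\phi\equiv\psi$; (iii) if $\vdash\Diamond\phi$, then $(\psi|\phi)$ is, up to $\equiv$, the unique solution $X\in\mathcal{L}$ of $X\wedge\phi\equiv\psi\wedge\phi$ satisfying $\vdash X\times\phi$.
   Context: Fix a set $\Theta$ of atomic propositions. The language $\mathcal{L}$ is the smallest set containing $\Theta$ and closed under the formation of $\neg\phi$, $\Box\phi$, $\phi\rightarrow\psi$ and the conditional $(\psi|\phi)$. Abbreviations: $\phi\vee\psi=\neg\phi\rightarrow\psi$, $\phi\wedge\psi=\neg(\neg\phi\vee\neg\psi)$, $\phi\leftrightarrow\psi=(\phi\rightarrow\psi)\wedge(\psi\rightarrow\phi)$, $\top=\theta_0\rightarrow\theta_0$ for a fixed $\theta_0\in\Theta$, $\bot=\neg\top$, $\Diamond\phi=\neg\Box\neg\phi$, and (logical independence) $\psi\times\phi=\Box\bigl((\psi|\phi)\leftrightarrow\psi\bigr)$. The theorems ($\vdash$) of DmBL are the smallest set containing all instances of the axiom schemes below and closed under modus ponens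 (from $\vdash\phi$ and $\vdash\phi\rightarrow\psi$ infer $\vdash\psi$) and necessitation m1 (from $\vdash\phi$ infer $\vdash\Box\phi$): c1 $\phi\rightarrow(\psi\rightarrow\phi)$; c2 $(\eta\rightarrow(\phi\rightarrow\psi))\rightarrow((\eta\rightarrow\phi)\rightarrow(\eta\rightarrow\psi))$; c3 $(\neg\phi\rightarrow\neg\psi)\rightarrow((\neg\phi\rightarrow\psi)\rightarrow\phi)$; m2 $\Box(\phi\rightarrow\psi)\rightarrow(\Box\phi\rightarrow\Box\psi)$; m3 $\Box\phi\rightarrow\phi$; b1 $\Box(\phi\rightarrow\psi)\rightarrow(\Box\neg\phi\vee\Box(\psi|\phi))$; b2 $((\psi\rightarrow\eta)|\phi)\rightarrow((\psi|\phi)\rightarrow(\eta|\phi))$; b3 $(\psi|\phi)\rightarrow(\phi\rightarrow\psi)$; b4 $\neg(\neg\psi|\phi)\leftrightarrow(\psi|\phi)$; b5 $(\psi\times\phi)\leftrightarrow(\phi\times\psi)$. The logic DmBL$_\ast$ is defined in the same way but with b5 replaced by the two schemes b5.weak.A $(\psi\times\neg\phi)\leftrightarrow(\psi\times\phi)$ and b5.weak.B $\Box(\psi\leftrightarrow\eta)\rightarrow\Box((\phi|\psi)\leftrightarrow(\phi|\eta))$. $\phi\equiv\psi$ means $\vdash\phi\leftrightarrow\psi$. -}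

module Defs where

open import Relation.Binary.PropositionalEquality using (_≡_)

data Form (Θ : Set) : Set where
  atom  : Θ → Form Θ
  ¬'_   : Form Θ → Form Θ
  □_    : Form Θ → Form Θ
  _⇒_   : Form Θ → Form Θ → Form Θ
  ⟨_∣_⟩ : Form Θ → Form Θ → Form Θ   -- ⟨ ψ ∣ φ ⟩ is the conditional (ψ|φ)

infixr 4 _⇒_
infix  7 ¬'_ □_

module _ {Θ : Set} where
  infixr 5 _∨'_
  infixr 6 _∧'_
  infix  3 _⇔_
  infix  7 ◇_
  _∨'_ : Form Θ → Form Θ → Form Θ
  φ ∨' ψ = (¬' φ) ⇒ ψ

  _∧'_ : Form Θ → Form Θ → Form Θ
  φ ∧' ψ = ¬' ((¬' φ) ∨' (¬' ψ))

  _⇔_ : Form Θ → Form Θ → Form Θ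
  φ ⇔ ψ = (φ ⇒ ψ) ∧' (ψ ⇒ φ)

  ◇_ : Form Θ → Form Θ
  ◇ φ = ¬' (□ (¬' φ))

  -- logical independence ψ × φ = □((ψ|φ) ↔ ψ)
  _⊥⊥_ : Form Θ → Form Θ → Form Θ
  ψ ⊥⊥ φ = □ (⟨ ψ ∣ φ ⟩ ⇔ ψ)

⊤' : {Θ : Set} → Θ → Form Θ
⊤' θ₀ = atom θ₀ ⇒ atom θ₀

⊥' : {Θ : Set} → Θ → Form Θ
⊥' θ₀ = ¬' (⊤' θ₀)

data Logic : Set where
  DmBL DmBL* : Logic

data ⊢ {Θ : Set} (L : Logic) : Form Θ → Set where
  c1 : ∀ φ ψ → ⊢ L (φ ⇒ (ψ ⇒ φ))
  c2 : ∀ η φ ψ → ⊢ L ((η ⇒ (φ ⇒ ψ)) ⇒ ((η ⇒ φ) ⇒ (η ⇒ ψ)))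
  c3 : ∀ φ ψ → ⊢ L (((¬' φ) ⇒ (¬' ψ)) ⇒ (((¬' φ) ⇒ ψ) ⇒ φ))
  m2 : ∀ φ ψ → ⊢ L (□ (φ ⇒ ψ) ⇒ (□ φ ⇒ □ ψ))
  m3 : ∀ φ → ⊢ L (□ φ ⇒ φ)
  b1 : ∀ φ ψ → ⊢ L (□ (φ ⇒ ψ) ⇒ ((□ (¬' φ)) ∨' (□ ⟨ ψ ∣ φ ⟩)))
  b2 : ∀ φ ψ η → ⊢ L (⟨ ψ ⇒ η ∣ φ ⟩ ⇒ (⟨ ψ ∣ φ ⟩ ⇒ ⟨ η ∣ φ ⟩))
  b3 : ∀ φ ψ → ⊢ L (⟨ ψ ∣ φ ⟩ ⇒ (φ ⇒ ψ))
  b4 : ∀ φ ψ → ⊢ L ((¬' ⟨ ¬' ψ ∣ φ ⟩) ⇔ ⟨ ψ ∣ φ ⟩)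
  b5 : L ≡ DmBL → ∀ φ ψ → ⊢ L ((ψ ⊥⊥ φ) ⇔ (φ ⊥⊥ ψ))
  b5wA : L ≡ DmBL* → ∀ φ ψ → ⊢ L ((ψ ⊥⊥ (¬' φ)) ⇔ (ψ ⊥⊥ φ))
  b5wB : L ≡ DmBL* → ∀ φ ψ η → ⊢ L (□ (ψ ⇔ η) ⇒ □ (⟨ φ ∣ ψ ⟩ ⇔ ⟨ φ ∣ η ⟩))
  mp : ∀ {φ ψ} → ⊢ L φ → ⊢ L (φ ⇒ ψ) → ⊢ L ψ
  m1 : ∀ {φ} → ⊢ L φ → ⊢ L (□ φ)

_⊢_≣_ : {Θ : Set} → Logic → Form Θ → Form Θ → Set
L ⊢ φ ≣ ψ = ⊢ L (φ ⇔ ψ)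

-- So if X is independent of φ, then X ≡ (X|φ) is determined
-- by X ∧ φ up to ≡; and (ψ|φ) is itself independent of φ because (ψ|φ) ∧ φ ≡ ψ ∧ φ.
module Submission where

open import Data.List using (List; []; _∷_)
open import Data.List.Membership.Propositional using (_∈_)
open import Data.List.Relation.Unary.All using (All; []; _∷_)
open import Data.List.Relation.Unary.Any using (here; there)
open import Data.Product using (_×_; _,_)
open import Relation.Binary.Bundles using (Setoid)
open import Relation.Binary.PropositionalEquality using (refl)
import Relation.Binary.Reasoning.Setoid as SetoidReasoning

open import Defs

module Derivations {Θ : Set} (L : Logic) where

  infix  2 _⊩_
  infixl 5 _·_

  private variable
    Γ Δ         : List (Form Θ)
    A B C D X Y : Form Θ

  -- Hypotheses are closed under modus ponens only (necessitation stays with ⊢),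
  -- which is what makes the deduction theorem ⇒-intro hold.
  data _⊩_ (Γ : List (Form Θ)) : Form Θ → Set where
    hyp : A ∈ Γ → Γ ⊩ A
    thm : ⊢ L A → Γ ⊩ A
    _·_ : Γ ⊩ (A ⇒ B) → Γ ⊩ A → Γ ⊩ B

  ⇒-refl : (A : Form Θ) → ⊢ L (A ⇒ A)
  ⇒-refl A = mp (c1 A A) (mp (c1 A (A ⇒ A)) (c2 A (A ⇒ A) A))

  ⇒-intro : (A ∷ Γ) ⊩ B → Γ ⊩ (A ⇒ B)
  ⇒-intro {A = A} (hyp (here refl)) = thm (⇒-refl A)
  ⇒-intro (hyp (there p))           = thm (c1 _ _) · hyp p
  ⇒-intro (thm t)                   = thm (c1 _ _) · thm t
  ⇒-intro (f · x)                   = thm (c2 _ _ _) · ⇒-intro f · ⇒-intro x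

  closed : [] ⊩ A → ⊢ L A
  closed (hyp ())
  closed (thm t) = t
  closed (f · x) = mp (closed x) (closed f)

  weaken : Γ ⊩ A → (B ∷ Γ) ⊩ A
  weaken (hyp p) = hyp (there p)
  weaken (thm t) = thm t
  weaken (f · x) = weaken f · weaken x

  hyp₀ : (A ∷ Γ) ⊩ A
  hyp₀ = hyp (here refl)

  hyp₁ : (B ∷ A ∷ Γ) ⊩ A
  hyp₁ = weaken hyp₀

  hyp₂ : (C ∷ B ∷ A ∷ Γ) ⊩ A
  hyp₂ = weaken hyp₁

  hyp₃ : (D ∷ C ∷ B ∷ A ∷ Γ) ⊩ A
  hyp₃ = weaken hyp₂

  ¬-elim : Γ ⊩ ¬' A → Γ ⊩ A → Γ ⊩ B
  ¬-elim {A = A} {B = B} ¬a a = thm (c3 B A) · (thm (c1 _ _) · ¬a) · (thm (c1 _ _) · a)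

  by-contradiction : (¬' A ∷ Γ) ⊩ B → (¬' A ∷ Γ) ⊩ ¬' B → Γ ⊩ A
  by-contradiction {A = A} {B = B} b ¬b = thm (c3 A B) · ⇒-intro ¬b · ⇒-intro b

  ¬¬-elim : Γ ⊩ ¬' ¬' A → Γ ⊩ A
  ¬¬-elim ¬¬a = by-contradiction hyp₀ (weaken ¬¬a)

  ¬-intro : (A ∷ Γ) ⊩ B → (A ∷ Γ) ⊩ ¬' B → Γ ⊩ ¬' A
  ¬-intro b ¬b =
    by-contradiction (weaken (⇒-intro b) · ¬¬-elim hyp₀) (weaken (⇒-intro ¬b) · ¬¬-elim hyp₀)

  ∧-intro : Γ ⊩ A → Γ ⊩ B → Γ ⊩ (A ∧' B)
  ∧-intro a b = ¬-intro (weaken b) (hyp₀ · ¬-intro (weaken (weaken a)) hyp₀)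

  ∧-elimˡ : Γ ⊩ (A ∧' B) → Γ ⊩ A
  ∧-elimˡ ab = by-contradiction (⇒-intro (¬-elim hyp₀ hyp₁)) (weaken ab)

  ∧-elimʳ : Γ ⊩ (A ∧' B) → Γ ⊩ B
  ∧-elimʳ ab = by-contradiction (thm (c1 _ _) · hyp₀) (weaken ab)

  ⇔-intro : (A ∷ Γ) ⊩ B → (B ∷ Γ) ⊩ A → Γ ⊩ (A ⇔ B)
  ⇔-intro f g = ∧-intro (⇒-intro f) (⇒-intro g)

  ⇔-to : Γ ⊩ (A ⇔ B) → Γ ⊩ A → Γ ⊩ B
  ⇔-to e a = ∧-elimˡ e · a

  ⇔-from : Γ ⊩ (A ⇔ B) → Γ ⊩ B → Γ ⊩ A
  ⇔-from e b = ∧-elimʳ e · b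

  ≣-to : L ⊢ A ≣ B → ⊢ L (A ⇒ B)
  ≣-to e = closed (∧-elimˡ (thm e))

  ≣-from : L ⊢ A ≣ B → ⊢ L (B ⇒ A)
  ≣-from e = closed (∧-elimʳ (thm e))

  ≣-setoid : Setoid _ _
  ≣-setoid = record
    { Carrier       = Form Θ
    ; _≈_           = λ A B → L ⊢ A ≣ B
    ; isEquivalence = record
      { refl  = closed (⇔-intro hyp₀ hyp₀)
      ; sym   = λ e → closed (⇔-intro (⇔-from (thm e) hyp₀) (⇔-to (thm e) hyp₀))
      ; trans = λ e f → closed (⇔-intro (⇔-to (thm f) (⇔-to (thm e) hyp₀))
                                        (⇔-from (thm e) (⇔-from (thm f) hyp₀)))
      }
    }

  open Setoid ≣-setoid using () renaming (sym to ≣-sym; trans to ≣-trans)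

  □-lift : Δ ⊩ C → All (λ A → Γ ⊩ □ A) Δ → Γ ⊩ □ C
  □-lift d []       = thm (m1 (closed d))
  □-lift d (a ∷ as) = thm (m2 _ _) · □-lift (⇒-intro d) as · a

  independent⇒cond≣ : {φ : Form Θ} → ⊢ L (X ⊥⊥ φ) → L ⊢ ⟨ X ∣ φ ⟩ ≣ X
  independent⇒cond≣ ind = mp ind (m3 _)

  ¬cond⇒cond¬ : {φ ψ : Form Θ} → Γ ⊩ ¬' ⟨ ψ ∣ φ ⟩ → Γ ⊩ ⟨ ¬' ψ ∣ φ ⟩
  ¬cond⇒cond¬ {φ = φ} {ψ = ψ} ¬c = ¬¬-elim (¬-intro (⇔-to (thm (b4 φ ψ)) hyp₀) (weaken ¬c))

  cond∧≣∧ : (φ ψ : Form Θ) → L ⊢ (⟨ ψ ∣ φ ⟩ ∧' φ) ≣ (ψ ∧' φ)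
  cond∧≣∧ φ ψ = closed (⇔-intro
    (∧-intro (thm (b3 φ ψ) · ∧-elimˡ hyp₀ · ∧-elimʳ hyp₀) (∧-elimʳ hyp₀))
    (∧-intro (by-contradiction (∧-elimˡ hyp₁)
                               (thm (b3 φ (¬' ψ)) · ¬cond⇒cond¬ hyp₀ · ∧-elimʳ hyp₁))
             (∧-elimʳ hyp₀)))

  independent-cancel-□⇒ : (φ ψ η : Form Θ) →
    ⊢ L (((φ ⊥⊥ η) ∧' (ψ ⊥⊥ η)) ⇒ (□ ((φ ∧' η) ⇒ (ψ ∧' η)) ⇒ ((□ (¬' η)) ∨' (□ (φ ⇒ ψ)))))
  independent-cancel-□⇒ φ ψ η = closed (⇒-intro (⇒-intro (⇒-intro
    (□-lift conditionals⇒ (□-cond-⇒ ∷ ∧-elimˡ hyp₂ ∷ ∧-elimʳ hyp₂ ∷ [])))))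
    where
    curry∧ : ((φ ∧' η) ⇒ (ψ ∧' η)) ∷ [] ⊩ η ⇒ (φ ⇒ ψ)
    curry∧ = ⇒-intro (⇒-intro (∧-elimˡ (hyp₂ · ∧-intro hyp₀ hyp₁)))

    □-cond-⇒ : ¬' □ (¬' η) ∷ □ ((φ ∧' η) ⇒ (ψ ∧' η)) ∷ Γ ⊩ □ ⟨ φ ⇒ ψ ∣ η ⟩
    □-cond-⇒ = thm (b1 η (φ ⇒ ψ)) · □-lift curry∧ (hyp₁ ∷ []) · hyp₀

    conditionals⇒ : ⟨ φ ⇒ ψ ∣ η ⟩ ∷ (⟨ φ ∣ η ⟩ ⇔ φ) ∷ (⟨ ψ ∣ η ⟩ ⇔ ψ) ∷ [] ⊩ φ ⇒ ψ
    conditionals⇒ = ⇒-intro (⇔-to hyp₃ (thm (b2 η φ ψ) · hyp₁ · ⇔-from hyp₂ hyp₀))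

  module Possible (φ : Form Θ) (◇φ : ⊢ L (◇ φ)) where

    open SetoidReasoning ≣-setoid

    cond-intro : ⊢ L (φ ⇒ X) → ⊢ L ⟨ X ∣ φ ⟩
    cond-intro t = mp (mp ◇φ (mp (m1 t) (b1 _ _))) (m3 _)

    cond-mono : ⊢ L (X ⇒ Y) → ⊢ L (⟨ X ∣ φ ⟩ ⇒ ⟨ Y ∣ φ ⟩)
    cond-mono t = mp (cond-intro (mp t (c1 _ φ))) (b2 _ _ _)

    cond-cong : L ⊢ X ≣ Y → L ⊢ ⟨ X ∣ φ ⟩ ≣ ⟨ Y ∣ φ ⟩
    cond-cong e = closed (∧-intro (thm (cond-mono (≣-to e))) (thm (cond-mono (≣-from e))))

    cond-absorbs-∧ : (X : Form Θ) → L ⊢ ⟨ X ∣ φ ⟩ ≣ ⟨ X ∧' φ ∣ φ ⟩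
    cond-absorbs-∧ X = closed (⇔-intro
      (thm (b2 _ _ _) · (thm (cond-mono pair) · hyp₀) · thm (cond-intro (⇒-refl φ)))
      (thm (cond-mono (closed (⇒-intro (∧-elimˡ hyp₀)))) · hyp₀))
      where
      pair : ⊢ L (X ⇒ (φ ⇒ (X ∧' φ)))
      pair = closed (⇒-intro (⇒-intro (∧-intro hyp₁ hyp₀)))

    cond-respects-∧ : L ⊢ (X ∧' φ) ≣ (Y ∧' φ) → L ⊢ ⟨ X ∣ φ ⟩ ≣ ⟨ Y ∣ φ ⟩
    cond-respects-∧ {X = X} {Y = Y} e = begin
      ⟨ X ∣ φ ⟩       ≈⟨ cond-absorbs-∧ X ⟩
      ⟨ X ∧' φ ∣ φ ⟩  ≈⟨ cond-cong e ⟩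
      ⟨ Y ∧' φ ∣ φ ⟩  ≈⟨ cond-absorbs-∧ Y ⟨
      ⟨ Y ∣ φ ⟩       ∎

    independent-cancel-∧ : ⊢ L (X ⊥⊥ φ) → ⊢ L (Y ⊥⊥ φ) →
                           L ⊢ (X ∧' φ) ≣ (Y ∧' φ) → L ⊢ X ≣ Y
    independent-cancel-∧ {X = X} {Y = Y} indX indY e = begin
      X          ≈⟨ independent⇒cond≣ indX ⟨
      ⟨ X ∣ φ ⟩  ≈⟨ cond-respects-∧ e ⟩
      ⟨ Y ∣ φ ⟩  ≈⟨ independent⇒cond≣ indY ⟩
      Y          ∎

    cond-independent : (ψ : Form Θ) → ⊢ L (⟨ ψ ∣ φ ⟩ ⊥⊥ φ)
    cond-independent ψ = m1 (cond-respects-∧ (cond∧≣∧ φ ψ))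

    cond-unique : {ψ : Form Θ} → L ⊢ (X ∧' φ) ≣ (ψ ∧' φ) → ⊢ L (X ⊥⊥ φ) → L ⊢ X ≣ ⟨ ψ ∣ φ ⟩
    cond-unique {ψ = ψ} e ind =
      independent-cancel-∧ ind (cond-independent ψ) (≣-trans e (≣-sym (cond∧≣∧ φ ψ)))

mainTheorem10 : (Θ : Set) → (θ₀ : Θ) → (L : Logic) → (φ ψ η : Form Θ) →
      ⊢ L (((φ ⊥⊥ η) ∧' (ψ ⊥⊥ η)) ⇒ (□ ((φ ∧' η) ⇒ (ψ ∧' η)) ⇒ ((□ (¬' η)) ∨' (□ (φ ⇒ ψ)))))
    × (⊢ L (φ ⊥⊥ η) → ⊢ L (ψ ⊥⊥ η) → ⊢ L (◇ η) → L ⊢ (φ ∧' η) ≣ (ψ ∧' η) → L ⊢ φ ≣ ψ)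
    × (⊢ L (◇ φ) →
        (L ⊢ (⟨ ψ ∣ φ ⟩ ∧' φ) ≣ (ψ ∧' φ))
      × ⊢ L (⟨ ψ ∣ φ ⟩ ⊥⊥ φ)
      × ((X : Form Θ) → L ⊢ (X ∧' φ) ≣ (ψ ∧' φ) → ⊢ L (X ⊥⊥ φ) → L ⊢ X ≣ ⟨ ψ ∣ φ ⟩))
mainTheorem10 Θ _ L φ ψ η =
    independent-cancel-□⇒ φ ψ η
  , (λ indφ indψ ◇η → Possible.independent-cancel-∧ η ◇η indφ indψ)
  , λ ◇φ → let open Possible φ ◇φ in
      cond∧≣∧ φ ψ , cond-independent ψ , λ X → cond-unique {X = X}
  where open Derivations {Θ} L
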